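{- Let $E$ be a set of equations in the language of residuated ortholattices, and set $\mathsf V=\mathsf{OML}+E$ and $\mathsf W=\mathsf{ROL}+\mathrm T[E]$. Then: (1) $\mathsf V$ is a subvariety of $\mathsf W$; (2) if $\mathbf A\in\mathsf W$, then $\overline{\mathbf A}\in\mathsf V$.
   Context: A residuated ortholattice (ROL) is an algebra $(A,\wedge,\vee,\neg,\backslash,0,1)$ where $(A,\wedge,\vee,0,1)$ is a bounded lattice, $\neg$ is an order-reversing involution, and $x\cdot y\le z\iff y\le x\backslash z$ for all $x,y,z$, where $x\cdot y:=x\wedge(\neg x\vee y)$; $\mathsf{ROL}$ is the variety of ROLs. Orthomodular lattices (ortholattices satisfying $x\le y\implies y\approx x\vee(y\wedge\neg x)$) are regarded as ROLs with $x\backslash y:=\neg x\vee(x\wedge y)$ (this is the residual of $\cdot$ in any orthomodular lattice); $\mathsf{OML}$ denotes this subvariety of $\mathsf{ROL}$. For a variety $\mathsf K$ and set of equations $E$, $\mathsf K+E$ is the subvariety of $\mathsf K$ axiomatized by $E$. Let ${\sim}x:=x\backslash0$, $\overline x:={\sim}{\sim}x$, $x\Rightarrow_{\sim}y:={\sim}x\vee(x\wedge y)$; for an ROL $\mathbf A$, $\overline{\mathbf A}:=(\{\overline x:x\in A\},\wedge,\vee,{\sim},\Rightarrow_{\sim},0,1)$. The translation $\mathrm T$ on ROL terms: $\mathrm T(0)=0$, $\mathrm T(1)=1$, $\mathrm T(x)={\sim}{\sim}x$ for variables, $\mathrm T(\neg s)={\sim}\mathrm T(s)$, $\mathrm T(r\star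 s)=\mathrm T(r)\star\mathrm T(s)$ for $\star\in\{\wedge,\vee,\backslash\}$; and $\mathrm T[E]:=\{\mathrm T(u)\approx\mathrm T(v):(u\approx v)\in E\}$. -}

module Defs where

open import Level using (Level; _⊔_; suc)
open import Data.Nat using (ℕ)
open import Data.Product using (Σ; ∃; _×_; _,_; proj₁)
open import Relation.Unary using (Pred; _∈_)
open import Relation.Binary.Core using (Rel)
open import Relation.Binary.Structures using (IsEquivalence)
open import Algebra.Core using (Op₁; Op₂)
open import Algebra.Definitions using (Congruent₁; Congruent₂; Involutive)
open import Algebra.Lattice.Structures using (IsLattice)
open import Function.Bundles using (_⇔_)

record ROLAlg (c ℓ : Level) : Set (suc (c ⊔ ℓ)) where
  infix  4 _≈_ _≤_
  infixr 7 _∧_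
  infixr 6 _∨_
  infixr 5 _⟍_
  field
    Carrier : Set c
    _≈_     : Rel Carrier ℓ
    _∧_     : Op₂ Carrier
    _∨_     : Op₂ Carrier
    ¬_      : Op₁ Carrier
    _⟍_     : Op₂ Carrier
    𝟘       : Carrier
    𝟙       : Carrier

  _≤_ : Rel Carrier ℓ
  x ≤ y = (x ∧ y) ≈ x

  _·_ : Op₂ Carrier
  x · y = x ∧ (¬ x ∨ y)

  ∼_ : Op₁ Carrier
  ∼ x = x ⟍ 𝟘

  bar : Op₁ Carrier
  bar x = ∼ (∼ x)

  _⇒∼_ : Op₂ Carrier
  x ⇒∼ y = (∼ x) ∨ (x ∧ y)

record IsROL {c ℓ} (A : ROLAlg c ℓ) : Set (c ⊔ ℓ) where
  open ROLAlg A
  field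
    isLattice   : IsLattice _≈_ _∨_ _∧_
    ¬-cong      : Congruent₁ _≈_ ¬_
    ⟍-cong      : Congruent₂ _≈_ _⟍_
    𝟘-least     : ∀ x → 𝟘 ≤ x
    𝟙-greatest  : ∀ x → x ≤ 𝟙
    ¬-involutive : Involutive _≈_ ¬_
    ¬-antitone  : ∀ x y → x ≤ y → ¬ y ≤ ¬ x
    residuation : ∀ x y z → (x · y ≤ z) ⇔ (y ≤ x ⟍ z)

record IsOML {c ℓ} (A : ROLAlg c ℓ) : Set (c ⊔ ℓ) where
  open ROLAlg A
  field
    isROL          : IsROL A
    complement-∧   : ∀ x → (x ∧ ¬ x) ≈ 𝟘
    complement-∨   : ∀ x → (x ∨ ¬ x) ≈ 𝟙
    orthomodular   : ∀ x y → x ≤ y → y ≈ (x ∨ (y ∧ ¬ x))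
    ⟍-def          : ∀ x y → (x ⟍ y) ≈ (¬ x ∨ (x ∧ y))

data Term : Set where
  var  : ℕ → Term
  `0   : Term
  `1   : Term
  `¬_  : Term → Term
  _`∧_ : Term → Term → Term
  _`∨_ : Term → Term → Term
  _`⟍_ : Term → Term → Term

Equation : Set
Equation = Term × Term

module _ {c ℓ} (A : ROLAlg c ℓ) where
  open ROLAlg A

  ⟦_⟧ : Term → (ℕ → Carrier) → Carrier
  ⟦ var i  ⟧ ρ = ρ i
  ⟦ `0     ⟧ ρ = 𝟘
  ⟦ `1     ⟧ ρ = 𝟙
  ⟦ `¬ s   ⟧ ρ = ¬ (⟦ s ⟧ ρ)
  ⟦ r `∧ s ⟧ ρ = ⟦ r ⟧ ρ ∧ ⟦ s ⟧ ρ
  ⟦ r `∨ s ⟧ ρ = ⟦ r ⟧ ρ ∨ ⟦ s ⟧ ρ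
  ⟦ r `⟍ s ⟧ ρ = ⟦ r ⟧ ρ ⟍ ⟦ s ⟧ ρ

  Satisfies : Equation → Set (c ⊔ ℓ)
  Satisfies (u , v) = ∀ (ρ : ℕ → Carrier) → ⟦ u ⟧ ρ ≈ ⟦ v ⟧ ρ

`∼_ : Term → Term
`∼ s = s `⟍ `0

T : Term → Term
T (var i)  = `∼ (`∼ (var i))
T `0       = `0
T `1       = `1
T (`¬ s)   = `∼ (T s)
T (r `∧ s) = T r `∧ T s
T (r `∨ s) = T r `∨ T s
T (r `⟍ s) = T r `⟍ T s

T-eq : Equation → Equation
T-eq (u , v) = T u , T v

InOML+ : ∀ {e c ℓ} → Pred Equation e → ROLAlg c ℓ → Set (e ⊔ c ⊔ ℓ)
InOML+ E A = IsOML A × (∀ eq → eq ∈ E → Satisfies A eq)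

InROL+T : ∀ {e c ℓ} → Pred Equation e → ROLAlg c ℓ → Set (e ⊔ c ⊔ ℓ)
InROL+T E A = IsROL A × (∀ eq → eq ∈ E → Satisfies A (T-eq eq))

module _ {c ℓ} (A : ROLAlg c ℓ) where
  open ROLAlg A

  IsBar : Carrier → Set (c ⊔ ℓ)
  IsBar a = ∃ λ x → a ≈ bar x

  record BarClosed : Set (c ⊔ ℓ) where
    field
      ∧-closed  : ∀ a b → IsBar a → IsBar b → IsBar (a ∧ b)
      ∨-closed  : ∀ a b → IsBar a → IsBar b → IsBar (a ∨ b)
      ∼-closed  : ∀ a → IsBar a → IsBar (∼ a)
      ⇒∼-closed : ∀ a b → IsBar a → IsBar b → IsBar (a ⇒∼ b)
      𝟘-closed  : IsBar 𝟘
      𝟙-closed  : IsBar 𝟙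

  Bar : BarClosed → ROLAlg (c ⊔ ℓ) ℓ
  Bar cl = record
    { Carrier = Σ Carrier IsBar
    ; _≈_     = λ a b → proj₁ a ≈ proj₁ b
    ; _∧_     = λ { (a , p) (b , q) → (a ∧ b) , ∧-closed a b p q }
    ; _∨_     = λ { (a , p) (b , q) → (a ∨ b) , ∨-closed a b p q }
    ; ¬_      = λ { (a , p) → (∼ a) , ∼-closed a p }
    ; _⟍_     = λ { (a , p) (b , q) → (a ⇒∼ b) , ⇒∼-closed a b p q }
    ; 𝟘       = 𝟘 , 𝟘-closed
    ; 𝟙       = 𝟙 , 𝟙-closed
    }
    where open BarClosed cl

{-# OPTIONS --safe #-}
-- The residual negation ∼ x = x ⟍ 𝟘 lies above ¬ x and is self-adjoint (y ≤ ∼ x iff x ≤ ∼ y),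
-- so ∼ ∼ is a closure operator.  The crucial inequality is y · x ≤ ∼ ∼ x for x ≤ y: every
-- closed element a absorbs y · a for y above it.  With it, the closed elements are closed
-- under ∧, ∨ and ∼; on them a ⟍ b coincides with ∼ a ∨ (a ∧ b) and ∼ is an orthomodular
-- orthocomplement.  So Ā is an orthomodular lattice in which a term s is computed as T s
-- is computed in A, which transfers T[E] from A to E in Ā.  Conversely, in an orthomodular
-- lattice ∼ = ¬, so T s and s have the same value.

module Submission where

open import Defs
open import Level using (_⊔_)
open import Data.Nat using (ℕ)
open import Data.Product using (Σ; _×_; _,_; proj₁)
open import Function.Base using (_∘_)
open import Function.Bundles using (mk⇔; Equivalence)
open import Relation.Unary using (Pred)
open import Relation.Binary.Lattice using (IsLattice; Lattice)
import Algebra.Lattice.Structures as Algebraic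
import Algebra.Lattice.Bundles as AlgebraicBundles
import Algebra.Lattice.Properties.Lattice as AlgebraicLatticeProperties
open import Algebra.Lattice.Morphism.Structures using (module LatticeMorphisms)
import Algebra.Lattice.Morphism.LatticeMonomorphism as LatticeMonomorphism
import Relation.Binary.Lattice.Properties.MeetSemilattice as MeetSemilatticeProperties
import Relation.Binary.Lattice.Properties.JoinSemilattice as JoinSemilatticeProperties
import Relation.Binary.Reasoning.PartialOrder as PartialOrderReasoning

module ROLProperties {c ℓ} (A : ROLAlg c ℓ) (isROL : IsROL A) where
  open ROLAlg A
  open IsROL isROL
  open Algebraic.IsLattice isLattice
    using (isEquivalence; ∧-cong; ∨-cong; ∧-comm)
    renaming (sym to ≈-sym; trans to ≈-trans; refl to ≈-refl)

  ≤-isLattice : IsLattice _≈_ _≤_ _∨_ _∧_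
  ≤-isLattice = record
    { isPartialOrder = record
      { isPreorder = record
        { isEquivalence = isEquivalence
        ; reflexive     = λ x≈y → ≈-sym (N.reflexive x≈y)
        ; trans         = λ p q → ≈-sym (N.trans (≈-sym p) (≈-sym q))
        }
      ; antisym = λ p q → N.antisym (≈-sym p) (≈-sym q)
      }
    ; supremum = λ x y → ≈-sym (N.x≤x∨y x y) , ≈-sym (N.y≤x∨y x y)
                       , λ z p q → ≈-sym (N.∨-least (≈-sym p) (≈-sym q))
    ; infimum  = λ x y → ≈-sym (N.x∧y≤x x y) , ≈-sym (N.x∧y≤y x y)
                       , λ z p q → ≈-sym (N.∧-greatest (≈-sym p) (≈-sym q))
    }
    where
    -- the library's natural order is  x ≈ x ∧ y,  the mirror image of  x ∧ y ≈ x
    algebraicLattice : AlgebraicBundles.Lattice c ℓ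
    algebraicLattice = record { isLattice = isLattice }
    module N = IsLattice (AlgebraicLatticeProperties.∨-∧-isOrderTheoreticLattice algebraicLattice)

  ≤-lattice : Lattice c ℓ ℓ
  ≤-lattice = record { isLattice = ≤-isLattice }

  open Lattice ≤-lattice public
    using (poset; x≤x∨y; y≤x∨y; ∨-least; x∧y≤x; x∧y≤y; ∧-greatest; ≤-respˡ-≈; ≤-respʳ-≈)
    renaming (refl to ≤-refl; reflexive to ≤-reflexive; trans to ≤-trans; antisym to ≤-antisym)
  open MeetSemilatticeProperties (Lattice.meetSemilattice ≤-lattice) public using (∧-monotonic)
  open JoinSemilatticeProperties (Lattice.joinSemilattice ≤-lattice) public using (∨-monotonic)
  open PartialOrderReasoning poset

  ∧-comm-≤ : ∀ {x y} → x ∧ y ≤ y ∧ x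
  ∧-comm-≤ {x} {y} = ≤-reflexive (∧-comm x y)

  ¬-antimono : ∀ {x y} → x ≤ y → ¬ y ≤ ¬ x
  ¬-antimono {x} {y} = ¬-antitone x y

  ¬-transposeˡ : ∀ {x y} → ¬ x ≤ y → ¬ y ≤ x
  ¬-transposeˡ {x} p = ≤-trans (¬-antimono p) (≤-reflexive (¬-involutive x))

  ¬-transposeʳ : ∀ {x y} → x ≤ ¬ y → y ≤ ¬ x
  ¬-transposeʳ {y = y} p = ≤-trans (≤-reflexive (≈-sym (¬-involutive y))) (¬-antimono p)

  ¬-∨ : ∀ x y → ¬ (x ∨ y) ≈ ¬ x ∧ ¬ y
  ¬-∨ x y = ≤-antisym
    (∧-greatest (¬-antimono (x≤x∨y x y)) (¬-antimono (y≤x∨y x y)))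
    (¬-transposeʳ (∨-least (¬-transposeʳ (x∧y≤x _ _)) (¬-transposeʳ (x∧y≤y _ _))))

  ¬-∧ : ∀ x y → ¬ (x ∧ y) ≈ ¬ x ∨ ¬ y
  ¬-∧ x y = begin-equality
    ¬ (x ∧ y)          ≈⟨ ¬-cong (∧-cong (¬-involutive x) (¬-involutive y)) ⟨
    ¬ (¬ ¬ x ∧ ¬ ¬ y)  ≈⟨ ¬-cong (¬-∨ (¬ x) (¬ y)) ⟨
    ¬ ¬ (¬ x ∨ ¬ y)    ≈⟨ ¬-involutive _ ⟩
    ¬ x ∨ ¬ y          ∎

  transpose-⟍ : ∀ {x y z} → x · y ≤ z → y ≤ x ⟍ z
  transpose-⟍ {x} {y} {z} = Equivalence.to (residuation x y z)

  transpose-· : ∀ {x y z} → y ≤ x ⟍ z → x · y ≤ z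
  transpose-· {x} {y} {z} = Equivalence.from (residuation x y z)

  ·-monoʳ : ∀ {x y z} → y ≤ z → x · y ≤ x · z
  ·-monoʳ p = ∧-monotonic ≤-refl (∨-monotonic ≤-refl p)

  x·[y∨z]≤x·y∨x·z : ∀ {x y z} → x · (y ∨ z) ≤ x · y ∨ x · z
  x·[y∨z]≤x·y∨x·z = transpose-· (∨-least (transpose-⟍ (x≤x∨y _ _)) (transpose-⟍ (y≤x∨y _ _)))

  x∧y≤x·y : ∀ {x y} → x ∧ y ≤ x · y
  x∧y≤x·y = ∧-monotonic ≤-refl (y≤x∨y _ _)

  x·y≤¬x∨y : ∀ {x y} → x · y ≤ ¬ x ∨ y
  x·y≤¬x∨y = x∧y≤y _ _

  ¬x≤y⇒x·y≤x∧y : ∀ {x y} → ¬ x ≤ y → x · y ≤ x ∧ y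
  ¬x≤y⇒x·y≤x∧y p = ∧-monotonic ≤-refl (∨-least p ≤-refl)

  𝟙≤¬x∨y⇒x≤x·y : ∀ {x y} → 𝟙 ≤ ¬ x ∨ y → x ≤ x · y
  𝟙≤¬x∨y⇒x≤x·y {x} p = ∧-greatest ≤-refl (≤-trans (𝟙-greatest x) p)

  x·∼x≤𝟘 : ∀ {x} → x · (∼ x) ≤ 𝟘
  x·∼x≤𝟘 = transpose-· ≤-refl

  x∧¬x≤𝟘 : ∀ x → x ∧ ¬ x ≤ 𝟘
  x∧¬x≤𝟘 x = ≤-trans (∧-monotonic ≤-refl (x≤x∨y _ _)) x·∼x≤𝟘

  ¬x≤𝟘⇒𝟙≤x : ∀ {x} → ¬ x ≤ 𝟘 → 𝟙 ≤ x
  ¬x≤𝟘⇒𝟙≤x p = ≤-trans (¬-transposeʳ (𝟘-least (¬ 𝟙))) (¬-transposeˡ p)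

  𝟙≤x∨¬x : ∀ x → 𝟙 ≤ x ∨ ¬ x
  𝟙≤x∨¬x x = ¬x≤𝟘⇒𝟙≤x (≤-trans (≤-reflexive (¬-∨ x (¬ x))) (x∧¬x≤𝟘 (¬ x)))

  ∼-cong : ∀ {x y} → x ≈ y → ∼ x ≈ ∼ y
  ∼-cong x≈y = ⟍-cong x≈y ≈-refl

  ¬x≤∼x : ∀ x → ¬ x ≤ ∼ x
  ¬x≤∼x x = transpose-⟍ (≤-trans (¬x≤y⇒x·y≤x∧y ≤-refl) (x∧¬x≤𝟘 x))

  x∧∼x≤𝟘 : ∀ x → x ∧ ∼ x ≤ 𝟘
  x∧∼x≤𝟘 x = ≤-trans x∧y≤x·y x·∼x≤𝟘

  ≤∼-intro : ∀ {x y} → ¬ x ≤ y → x ∧ y ≤ 𝟘 → y ≤ ∼ x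
  ≤∼-intro p q = transpose-⟍ (≤-trans (¬x≤y⇒x·y≤x∧y p) q)

  x≤∼∼x : ∀ x → x ≤ ∼ ∼ x
  x≤∼∼x x = ≤∼-intro (¬-transposeˡ (¬x≤∼x x)) (≤-trans ∧-comm-≤ (x∧∼x≤𝟘 x))

  ∼-antimono : ∀ {x y} → x ≤ y → ∼ y ≤ ∼ x
  ∼-antimono {x} {y} x≤y = transpose-⟍ (≤-trans (∧-greatest (x∧y≤x _ _) x·∼y≤¬x) (x∧¬x≤𝟘 x))
    where
    x·∼y≤¬x : x · (∼ y) ≤ ¬ x
    x·∼y≤¬x = begin
      x · (∼ y)                  ≤⟨ ∧-monotonic x≤y (y≤x∨y _ _) ⟩
      y · (¬ x ∨ ∼ y)            ≤⟨ x·[y∨z]≤x·y∨x·z ⟩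
      y · (¬ x) ∨ y · (∼ y)      ≤⟨ ∨-monotonic (≤-trans x·y≤¬x∨y (∨-least (¬-antimono x≤y) ≤-refl)) x·∼x≤𝟘 ⟩
      ¬ x ∨ 𝟘                    ≤⟨ ∨-least ≤-refl (𝟘-least _) ⟩
      ¬ x                        ∎

  ∼-transpose : ∀ {x y} → y ≤ ∼ x → x ≤ ∼ y
  ∼-transpose {x} p = ≤-trans (x≤∼∼x x) (∼-antimono p)

  ∼∼∼x≈∼x : ∀ x → ∼ ∼ ∼ x ≈ ∼ x
  ∼∼∼x≈∼x x = ≤-antisym (∼-antimono (x≤∼∼x x)) (x≤∼∼x (∼ x))

  𝟙≤∼x⇒x≤𝟘 : ∀ {x} → 𝟙 ≤ ∼ x → x ≤ 𝟘
  𝟙≤∼x⇒x≤𝟘 {x} p = begin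
    x        ≤⟨ ∼-transpose p ⟩
    ∼ 𝟙      ≤⟨ ∧-greatest (𝟙-greatest _) ≤-refl ⟩
    𝟙 ∧ ∼ 𝟙  ≤⟨ x∧∼x≤𝟘 𝟙 ⟩
    𝟘        ∎

  x≤x·y∨x·∼y : ∀ x y → x ≤ x · y ∨ x · (∼ y)
  x≤x·y∨x·∼y x y = ≤-trans (𝟙≤¬x∨y⇒x≤x·y 𝟙≤¬x∨y∨∼y) x·[y∨z]≤x·y∨x·z
    where
    𝟙≤¬x∨y∨∼y : 𝟙 ≤ ¬ x ∨ y ∨ ∼ y
    𝟙≤¬x∨y∨∼y = ≤-trans (𝟙≤x∨¬x y) (≤-trans (∨-monotonic ≤-refl (¬x≤∼x y)) (y≤x∨y _ _))

  ∼∼x≈∼¬x : ∀ x → ∼ ∼ x ≈ ∼ ¬ x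
  ∼∼x≈∼¬x x = ≤-antisym (∼-antimono (¬x≤∼x x)) (∼-transpose (≤∼-intro ¬∼¬x≤∼x ∼¬x∧∼x≤𝟘))
    where
    ¬∼¬x≤∼x : ¬ ∼ ¬ x ≤ ∼ x
    ¬∼¬x≤∼x = ≤-trans (¬-transposeˡ (¬x≤∼x (¬ x))) (¬x≤∼x x)
    ∼¬x∧∼x≤𝟘 : ∼ ¬ x ∧ ∼ x ≤ 𝟘
    ∼¬x∧∼x≤𝟘 = 𝟙≤∼x⇒x≤𝟘 (≤-trans (𝟙≤x∨¬x x)
      (∨-least (∼-transpose (x∧y≤y _ _)) (∼-transpose (x∧y≤x _ _))))

  ¬x∧y·x≤𝟘 : ∀ x y → ¬ x ∧ y · x ≤ 𝟘
  ¬x∧y·x≤𝟘 x y = 𝟙≤∼x⇒x≤𝟘 (begin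
    𝟙            ≤⟨ 𝟙≤x∨¬x e ⟩
    e ∨ ¬ e      ≤⟨ ∨-monotonic ≤-refl (≤-reflexive ¬e≈¬y∨x) ⟩
    e ∨ ¬ y ∨ x  ≤⟨ ∨-least (∼-transpose t≤∼e) (∨-least ¬y≤∼t x≤∼t) ⟩
    ∼ t          ∎)
    where
    e = y ∧ ¬ x
    t = ¬ x ∧ y · x
    ¬e≈¬y∨x : ¬ e ≈ ¬ y ∨ x
    ¬e≈¬y∨x = ≈-trans (¬-∧ y (¬ x)) (∨-cong ≈-refl (¬-involutive x))
    t≤∼e : t ≤ ∼ e
    t≤∼e = ≤-trans (x∧y≤y _ _) (≤-trans x·y≤¬x∨y (≤-trans (≤-reflexive (≈-sym ¬e≈¬y∨x)) (¬x≤∼x e)))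
    ¬y≤∼t : ¬ y ≤ ∼ t
    ¬y≤∼t = ∼-transpose (≤-trans (x∧y≤y _ _) (≤-trans (x∧y≤x _ _)
      (≤-trans (≤-reflexive (≈-sym (¬-involutive y))) (¬x≤∼x (¬ y)))))
    x≤∼t : x ≤ ∼ t
    x≤∼t = ∼-transpose (≤-trans (x∧y≤x _ _) (¬x≤∼x x))

  y·x≤∼∼x : ∀ {x y} → x ≤ y → y · x ≤ ∼ ∼ x
  y·x≤∼∼x {x} {y} x≤y = ≤-trans (transpose-⟍ ¬x·y·x≤𝟘) (≤-reflexive (≈-sym (∼∼x≈∼¬x x)))
    where
    x≤y·x : x ≤ y · x
    x≤y·x = ∧-greatest x≤y (y≤x∨y _ _)
    ¬x·y·x≤𝟘 : (¬ x) · (y · x) ≤ 𝟘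
    ¬x·y·x≤𝟘 = ≤-trans (¬x≤y⇒x·y≤x∧y (≤-trans (≤-reflexive (¬-involutive x)) x≤y·x)) (¬x∧y·x≤𝟘 x y)

  -- As x ≤ ∼ ∼ x, the closed elements are the fixed points of ∼ ∼, i.e. the elements of Ā.

  Closed : Carrier → Set ℓ
  Closed a = ∼ ∼ a ≤ a

  IsBar⇒Closed : ∀ {a} → IsBar A a → Closed a
  IsBar⇒Closed {a} (x , a≈∼∼x) = begin
    ∼ ∼ a        ≈⟨ ∼-cong (∼-cong a≈∼∼x) ⟩
    ∼ ∼ (∼ ∼ x)  ≈⟨ ∼∼∼x≈∼x (∼ x) ⟩
    ∼ ∼ x        ≈⟨ a≈∼∼x ⟨
    a            ∎

  Closed⇒IsBar : ∀ {a} → Closed a → IsBar A a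
  Closed⇒IsBar {a} a-closed = a , ≤-antisym (x≤∼∼x a) a-closed

  Closed⇒y·a≤a : ∀ {a y} → Closed a → a ≤ y → y · a ≤ a
  Closed⇒y·a≤a a-closed a≤y = ≤-trans (y·x≤∼∼x a≤y) a-closed

  Closed-∼ : ∀ x → Closed (∼ x)
  Closed-∼ x = ≤-reflexive (∼∼∼x≈∼x x)

  Closed-𝟘 : Closed 𝟘
  Closed-𝟘 = 𝟙≤∼x⇒x≤𝟘 (≤-trans 𝟙≤∼𝟘 (x≤∼∼x (∼ 𝟘)))
    where
    𝟙≤∼𝟘 : 𝟙 ≤ ∼ 𝟘
    𝟙≤∼𝟘 = ≤∼-intro (𝟙-greatest _) (x∧y≤x _ _)

  Closed-𝟙 : Closed 𝟙
  Closed-𝟙 = 𝟙-greatest _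

  Closed-∧ : ∀ {a b} → Closed a → Closed b → Closed (a ∧ b)
  Closed-∧ a-closed b-closed = ∧-greatest
    (≤-trans (∼-antimono (∼-antimono (x∧y≤x _ _))) a-closed)
    (≤-trans (∼-antimono (∼-antimono (x∧y≤y _ _))) b-closed)

  Closed-∨ : ∀ {a b} → Closed a → Closed b → Closed (a ∨ b)
  Closed-∨ {a} {b} a-closed b-closed = begin
    w                  ≤⟨ 𝟙≤¬x∨y⇒x≤x·y 𝟙≤¬w∨z ⟩
    w · z              ≤⟨ x·[y∨z]≤x·y∨x·z ⟩
    w · a ∨ w · b      ≤⟨ ∨-monotonic (Closed⇒y·a≤a a-closed a≤w) (Closed⇒y·a≤a b-closed b≤w) ⟩
    z                  ∎
    where
    z = a ∨ b
    w = ∼ ∼ z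
    a≤w : a ≤ w
    a≤w = ≤-trans (x≤x∨y a b) (x≤∼∼x z)
    b≤w : b ≤ w
    b≤w = ≤-trans (y≤x∨y a b) (x≤∼∼x z)
    w∧¬z≤𝟘 : w ∧ ¬ z ≤ 𝟘
    w∧¬z≤𝟘 = ≤-trans ∧-comm-≤ (≤-trans (∧-monotonic ≤-refl (≤-reflexive (∼∼x≈∼¬x z))) (x∧∼x≤𝟘 (¬ z)))
    𝟙≤¬w∨z : 𝟙 ≤ ¬ w ∨ z
    𝟙≤¬w∨z = ¬x≤𝟘⇒𝟙≤x (begin
      ¬ (¬ w ∨ z)  ≈⟨ ¬-∨ (¬ w) z ⟩
      ¬ ¬ w ∧ ¬ z  ≈⟨ ∧-cong (¬-involutive w) ≈-refl ⟩
      w ∧ ¬ z      ≤⟨ w∧¬z≤𝟘 ⟩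
      𝟘            ∎)

  ·-cancelˡ-≤ : ∀ {x w v} → x · w ≤ x · v → w ≤ ∼ x ∨ v
  ·-cancelˡ-≤ {x} {w} {v} xw≤xv = ≤-trans (y≤x∨y q w) r≤q
    where
    q = ∼ x ∨ v
    r = q ∨ w
    ∼x≤r : ∼ x ≤ r
    ∼x≤r = ≤-trans (x≤x∨y _ _) (x≤x∨y _ _)
    r·x≤q : r · x ≤ q
    r·x≤q = begin
      r · x              ≤⟨ ¬x≤y⇒x·y≤x∧y (≤-trans (¬-antimono ∼x≤r) (¬-transposeˡ (¬x≤∼x x))) ⟩
      r ∧ x              ≤⟨ ≤-trans ∧-comm-≤ x∧y≤x·y ⟩
      x · r              ≤⟨ x·[y∨z]≤x·y∨x·z ⟩
      x · q ∨ x · w      ≤⟨ ∨-least ≤-refl (≤-trans xw≤xv (·-monoʳ (y≤x∨y _ _))) ⟩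
      x · q              ≤⟨ ≤-trans x·y≤¬x∨y (∨-least (≤-trans (¬x≤∼x x) (x≤x∨y _ _)) ≤-refl) ⟩
      q                  ∎
    r≤q : r ≤ q
    r≤q = begin
      r                  ≤⟨ x≤x·y∨x·∼y r x ⟩
      r · x ∨ r · (∼ x)  ≤⟨ ∨-least r·x≤q (≤-trans (Closed⇒y·a≤a (Closed-∼ x) ∼x≤r) (x≤x∨y _ _)) ⟩
      q                  ∎

  ·≈∧∼∨ : ∀ x y → x · y ≈ x ∧ (∼ x ∨ y)
  ·≈∧∼∨ x y = ≤-antisym (∧-monotonic ≤-refl (∨-monotonic (¬x≤∼x x) ≤-refl)) (begin
    x ∧ (∼ x ∨ y)          ≤⟨ x∧y≤x·y ⟩
    x · (∼ x ∨ y)          ≤⟨ x·[y∨z]≤x·y∨x·z ⟩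
    x · (∼ x) ∨ x · y      ≤⟨ ∨-least (≤-trans x·∼x≤𝟘 (𝟘-least _)) ≤-refl ⟩
    x · y                  ∎)

  ⟍≤⇒∼ : ∀ a b → a ⟍ b ≤ a ⇒∼ b
  ⟍≤⇒∼ a b = ·-cancelˡ-≤ (begin
    a · (a ⟍ b)  ≤⟨ ∧-greatest (x∧y≤x _ _) (transpose-· ≤-refl) ⟩
    a ∧ b        ≤⟨ ∧-greatest (x∧y≤x _ _) (y≤x∨y _ _) ⟩
    a · (a ∧ b)  ∎)

  ⟍≈⇒∼ : ∀ {a b} → Closed a → Closed b → a ⟍ b ≈ a ⇒∼ b
  ⟍≈⇒∼ {a} {b} a-closed b-closed = ≤-antisym (⟍≤⇒∼ a b) (transpose-⟍ (begin
    a · (a ⇒∼ b)             ≤⟨ x·[y∨z]≤x·y∨x·z ⟩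
    a · (∼ a) ∨ a · (a ∧ b)  ≤⟨ ∨-least (≤-trans x·∼x≤𝟘 (𝟘-least _)) a·[a∧b]≤b ⟩
    b                        ∎))
    where
    a·[a∧b]≤b : a · (a ∧ b) ≤ b
    a·[a∧b]≤b = ≤-trans (Closed⇒y·a≤a (Closed-∧ a-closed b-closed) (x∧y≤x _ _)) (x∧y≤y _ _)

  Closed-orthomodular : ∀ {a b} → Closed a → a ≤ b → b ≈ a ∨ (b ∧ ∼ a)
  Closed-orthomodular {a} {b} a-closed a≤b = ≤-antisym (begin
      b                      ≤⟨ x≤x·y∨x·∼y b a ⟩
      b · a ∨ b · (∼ a)      ≤⟨ ∨-monotonic (Closed⇒y·a≤a a-closed a≤b) (¬x≤y⇒x·y≤x∧y ¬b≤∼a) ⟩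
      a ∨ (b ∧ ∼ a)          ∎)
    (∨-least a≤b (x∧y≤x _ _))
    where
    ¬b≤∼a : ¬ b ≤ ∼ a
    ¬b≤∼a = ≤-trans (¬-antimono a≤b) (¬x≤∼x a)

  barClosed : BarClosed A
  barClosed = record
    { ∧-closed  = λ _ _ p q → Closed⇒IsBar (Closed-∧ (IsBar⇒Closed p) (IsBar⇒Closed q))
    ; ∨-closed  = λ _ _ p q → Closed⇒IsBar (Closed-∨ (IsBar⇒Closed p) (IsBar⇒Closed q))
    ; ∼-closed  = λ a _ → Closed⇒IsBar (Closed-∼ a)
    ; ⇒∼-closed = λ a _ p q →
        Closed⇒IsBar (Closed-∨ (Closed-∼ a) (Closed-∧ (IsBar⇒Closed p) (IsBar⇒Closed q)))
    ; 𝟘-closed  = Closed⇒IsBar Closed-𝟘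
    ; 𝟙-closed  = Closed⇒IsBar Closed-𝟙
    }

  Ā : ROLAlg (c ⊔ ℓ) ℓ
  Ā = Bar A barClosed

  private
    module Ā = ROLAlg Ā

  closed : (a : Ā.Carrier) → Closed (proj₁ a)
  closed (_ , p) = IsBar⇒Closed p

  Ā-rawLattice : AlgebraicBundles.RawLattice (c ⊔ ℓ) ℓ
  Ā-rawLattice = record { _≈_ = Ā._≈_ ; _∧_ = Ā._∧_ ; _∨_ = Ā._∨_ }

  rawLattice : AlgebraicBundles.RawLattice c ℓ
  rawLattice = record { _≈_ = _≈_ ; _∧_ = _∧_ ; _∨_ = _∨_ }

  proj₁-isLatticeMonomorphism : LatticeMorphisms.IsLatticeMonomorphism Ā-rawLattice rawLattice proj₁
  proj₁-isLatticeMonomorphism = record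
    { isLatticeHomomorphism = record
      { isRelHomomorphism = record { cong = λ a≈b → a≈b }
      ; ∧-homo = λ _ _ → ≈-refl
      ; ∨-homo = λ _ _ → ≈-refl
      }
    ; injective = λ a≈b → a≈b
    }

  Ā-isROL : IsROL Ā
  Ā-isROL = record
    { isLattice    = LatticeMonomorphism.isLattice proj₁-isLatticeMonomorphism isLattice
    ; ¬-cong       = ∼-cong
    ; ⟍-cong       = λ a≈b c≈d → ∨-cong (∼-cong a≈b) (∧-cong a≈b c≈d)
    ; 𝟘-least      = λ a → 𝟘-least (proj₁ a)
    ; 𝟙-greatest   = λ a → 𝟙-greatest (proj₁ a)
    ; ¬-involutive = λ a → ≤-antisym (closed a) (x≤∼∼x (proj₁ a))
    ; ¬-antitone   = λ _ _ → ∼-antimono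
    ; residuation  = λ a b c → mk⇔
        (λ p → ≤-respʳ-≈ (⟍≈⇒∼ (closed a) (closed c))
                 (transpose-⟍ (≤-respˡ-≈ (≈-sym (·≈∧∼∨ _ _)) p)))
        (λ p → ≤-respˡ-≈ (·≈∧∼∨ _ _)
                 (transpose-· (≤-respʳ-≈ (≈-sym (⟍≈⇒∼ (closed a) (closed c))) p)))
    }

  Ā-isOML : IsOML Ā
  Ā-isOML = record
    { isROL        = Ā-isROL
    ; complement-∧ = λ a → ≤-antisym (x∧∼x≤𝟘 (proj₁ a)) (𝟘-least _)
    ; complement-∨ = λ a → ≤-antisym (𝟙-greatest _)
        (≤-trans (𝟙≤x∨¬x (proj₁ a)) (∨-monotonic ≤-refl (¬x≤∼x (proj₁ a))))
    ; orthomodular = λ a _ → Closed-orthomodular (closed a)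
    ; ⟍-def        = λ _ _ → ≈-refl
    }

  ⟦⟧-Ā : ∀ s (ρ : ℕ → Ā.Carrier) → proj₁ (⟦_⟧ Ā s ρ) ≈ ⟦_⟧ A (T s) (proj₁ ∘ ρ)
  ⟦⟧-Ā (var i)  ρ = ≤-antisym (x≤∼∼x _) (closed (ρ i))
  ⟦⟧-Ā `0       ρ = ≈-refl
  ⟦⟧-Ā `1       ρ = ≈-refl
  ⟦⟧-Ā (`¬ s)   ρ = ∼-cong (⟦⟧-Ā s ρ)
  ⟦⟧-Ā (r `∧ s) ρ = ∧-cong (⟦⟧-Ā r ρ) (⟦⟧-Ā s ρ)
  ⟦⟧-Ā (r `∨ s) ρ = ∨-cong (⟦⟧-Ā r ρ) (⟦⟧-Ā s ρ)
  ⟦⟧-Ā (r `⟍ s) ρ = ≈-trans (≈-sym (⟍≈⇒∼ (closed (⟦_⟧ Ā r ρ)) (closed (⟦_⟧ Ā s ρ))))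
                             (⟍-cong (⟦⟧-Ā r ρ) (⟦⟧-Ā s ρ))

  Ā-satisfies : ∀ eq → Satisfies A (T-eq eq) → Satisfies Ā eq
  Ā-satisfies (u , v) A⊨Tu≈Tv ρ = ≈-trans (⟦⟧-Ā u ρ) (≈-trans (A⊨Tu≈Tv (proj₁ ∘ ρ)) (≈-sym (⟦⟧-Ā v ρ)))

module OMLProperties {c ℓ} (A : ROLAlg c ℓ) (isOML : IsOML A) where
  open ROLAlg A
  open IsOML isOML
  open IsROL isROL using (¬-cong; ¬-involutive; ⟍-cong; 𝟘-least)
  open ROLProperties A isROL using (≤-antisym; ≤-refl; ≤-trans; ∨-least; x≤x∨y; x∧y≤y)
  open Algebraic.IsLattice (IsROL.isLattice isROL)
    using (∧-cong; ∨-cong) renaming (refl to ≈-refl; sym to ≈-sym; trans to ≈-trans)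

  ∼≈¬ : ∀ x → ∼ x ≈ ¬ x
  ∼≈¬ x = ≈-trans (⟍-def x 𝟘) (≤-antisym (∨-least ≤-refl (≤-trans (x∧y≤y _ _) (𝟘-least _))) (x≤x∨y _ _))

  ⟦T⟧≈⟦⟧ : ∀ s ρ → ⟦_⟧ A (T s) ρ ≈ ⟦_⟧ A s ρ
  ⟦T⟧≈⟦⟧ (var i)  ρ = ≈-trans (∼≈¬ _) (≈-trans (¬-cong (∼≈¬ _)) (¬-involutive _))
  ⟦T⟧≈⟦⟧ `0       ρ = ≈-refl
  ⟦T⟧≈⟦⟧ `1       ρ = ≈-refl
  ⟦T⟧≈⟦⟧ (`¬ s)   ρ = ≈-trans (∼≈¬ _) (¬-cong (⟦T⟧≈⟦⟧ s ρ))
  ⟦T⟧≈⟦⟧ (r `∧ s) ρ = ∧-cong (⟦T⟧≈⟦⟧ r ρ) (⟦T⟧≈⟦⟧ s ρ)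
  ⟦T⟧≈⟦⟧ (r `∨ s) ρ = ∨-cong (⟦T⟧≈⟦⟧ r ρ) (⟦T⟧≈⟦⟧ s ρ)
  ⟦T⟧≈⟦⟧ (r `⟍ s) ρ = ⟍-cong (⟦T⟧≈⟦⟧ r ρ) (⟦T⟧≈⟦⟧ s ρ)

  satisfies-T : ∀ eq → Satisfies A eq → Satisfies A (T-eq eq)
  satisfies-T (u , v) A⊨u≈v ρ = ≈-trans (⟦T⟧≈⟦⟧ u ρ) (≈-trans (A⊨u≈v ρ) (≈-sym (⟦T⟧≈⟦⟧ v ρ)))

lemma4p10 : ∀ {e c ℓ} (E : Pred Equation e) →
    (∀ (A : ROLAlg c ℓ) → InOML+ E A → InROL+T E A)
    × (∀ (A : ROLAlg c ℓ) → InROL+T E A →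
        Σ (BarClosed A) (λ cl → InOML+ E (Bar A cl)))
lemma4p10 E = OML+E⊆ROL+T[E] , Ā∈OML+E
  where
  OML+E⊆ROL+T[E] : ∀ A → InOML+ E A → InROL+T E A
  OML+E⊆ROL+T[E] A (isOML , A⊨E) =
    IsOML.isROL isOML , λ eq eq∈E → OMLProperties.satisfies-T A isOML eq (A⊨E eq eq∈E)

  Ā∈OML+E : ∀ A → InROL+T E A → Σ (BarClosed A) (λ cl → InOML+ E (Bar A cl))
  Ā∈OML+E A (isROL , A⊨T[E]) =
    barClosed , Ā-isOML , λ eq eq∈E → Ā-satisfies eq (A⊨T[E] eq eq∈E)
    where open ROLProperties A isROL
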